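{- Let $k,r,s$ be positive integers, $d$ an integer, and let $A,C\in\mathbb{F}_q^{k\times r}$ and $B,D\in\mathbb{F}_q^{k\times s}$ with $\mathrm{rk}(A\mid B)=\mathrm{rk}(C\mid D)=k$. If (1) $\mathrm{rk}A=\mathrm{rk}C=k$ and $d\le d_S(\tau^{ -1}(A),\tau^{ -1}(C))$, or (2) $A=C$, $\mathrm{rk}A=k$ and $d/2\le\mathrm{rk}(B-D)$, or (3) $d/2\le|\mathrm{rk}A-\mathrm{rk}C|$, then $$d\le d_S(\tau^{ -1}(A\mid B),\tau^{ -1}(C\mid D))=d_S(\tau^{ -1}(B\mid A),\tau^{ -1}(D\mid C)).$$
   Context: $\mid$ denotes horizontal concatenation of matrices. For a matrix $X$ of full row rank, $\tau^{ -1}(X)$ denotes its row space. For subspaces $U,W$ of a common vector space, $d_S(U,W)=\dim(U+W)-\dim(U\cap W)$. -}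

module Defs where

open import Level using (0ℓ)
open import Algebra.Bundles using (CommutativeRing)
open import Data.Nat as ℕ using (ℕ; zero; suc)
open import Data.Integer as ℤ using (ℤ; +_)
open import Data.Fin using (Fin; zero; suc; splitAt)
open import Data.Sum using ([_,_])
open import Data.Product using (Σ; ∃; ∃-syntax; _×_; _,_)
open import Relation.Nullary using (¬_)
open import Relation.Binary.Definitions using (Decidable)
open import Relation.Binary.PropositionalEquality using (_≡_)

record FiniteField : Set₁ where
  field
    commRing : CommutativeRing 0ℓ 0ℓ
  open CommutativeRing commRing public
  field
    _≟_      : Decidable _≈_
    0≉1      : ¬ (0# ≈ 1#)
    inverse  : ∀ x → ¬ (x ≈ 0#) → ∃[ y ] (x * y ≈ 1#)
    size     : ℕ
    enum     : Fin size → Carrier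
    enum-onto : ∀ x → ∃[ i ] (enum i ≈ x)

module LinAlg (F : FiniteField) where
  open FiniteField F public using (Carrier; _≈_; _+_; _*_; _-_; 0#; 1#)

  Vect : ℕ → Set
  Vect n = Fin n → Carrier

  Mat : ℕ → ℕ → Set
  Mat k n = Fin k → Fin n → Carrier

  Pred : ℕ → Set₁
  Pred n = Vect n → Set

  sumF : ∀ {m} → (Fin m → Carrier) → Carrier
  sumF {zero}  f = 0#
  sumF {suc m} f = f zero + sumF (λ i → f (suc i))

  lincomb : ∀ {m n} → (Fin m → Carrier) → (Fin m → Vect n) → Vect n
  lincomb c v j = sumF (λ i → c i * v i j)

  Independent : ∀ {m n} → (Fin m → Vect n) → Set
  Independent {m} v = ∀ (c : Fin m → Carrier) →
    (∀ j → lincomb c v j ≈ 0#) → ∀ i → c i ≈ 0#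

  HasDim : ∀ {n} → Pred n → ℕ → Set
  HasDim {n} U m =
    (∃[ v ] ((∀ i → U (v i)) × Independent {m} {n} v)) ×
    (∀ m' (v : Fin m' → Vect n) → (∀ i → U (v i)) → Independent v → m' ℕ.≤ m)

  -- row space τ^{-1}(X) of a matrix
  RowSpace : ∀ {k n} → Mat k n → Pred n
  RowSpace X x = ∃[ c ] (∀ j → x j ≈ lincomb c X j)

  Rank : ∀ {k n} → Mat k n → ℕ → Set
  Rank X r = HasDim (RowSpace X) r

  _⊕_ : ∀ {n} → Pred n → Pred n → Pred n
  (U ⊕ W) x = ∃[ u ] ∃[ w ] (U u × W w × (∀ j → x j ≈ u j + w j))

  _∩_ : ∀ {n} → Pred n → Pred n → Pred n
  (U ∩ W) x = U x × W x

  DS : ∀ {n} → Pred n → Pred n → ℤ → Set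
  DS U W e = ∃[ a ] ∃[ b ] (HasDim (U ⊕ W) a × HasDim (U ∩ W) b × e ≡ (+ a) ℤ.- (+ b))

  _∥_ : ∀ {k r s} → Mat k r → Mat k s → Mat k (r ℕ.+ s)
  _∥_ {r = r} X Y i j = [ X i , Y i ] (splitAt r j)

  _⊖_ : ∀ {k n} → Mat k n → Mat k n → Mat k n
  (X ⊖ Y) i j = X i j - Y i j

-- Write U = τ(A|B) and W = τ(C|D), both of dimension k, and restrict vectors to their first r
-- coordinates. (1) The restriction maps U + W onto τA + τC and, A having independent rows, is injective
-- on U ∩ W, so d_S can only grow. (2) If A = C, then U + W contains U and the vectors (0 | g(B - D)), so
-- dim(U + W) ≥ k + rk(B - D); a vector of U ∩ W has the same coefficients over both matrices, and these
-- lie in the left kernel of B - D, so dim(U ∩ W) ≤ k - rk(B - D). (3) For rk A ≥ rk C, rank-nullity for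
-- the restriction, whose kernel meets U in dimension k - rk A, gives dim(U ∩ W) ≤ rk C + k - rk A and
-- k = dim W ≤ rk C + dim(U + W) - rk A; add the two. Swapping the blocks permutes coordinates, which
-- preserves all dimensions.
-- Dimension is defined by counting independent families, so everything rests on Steinitz exchange and
-- rank-nullity; over a finite field, linear dependence is decidable by enumerating coefficients.
module Submission where

open import Defs
open import Data.Nat as ℕ using (ℕ; zero; suc; z≤n; s≤s; _≤_; _∸_; ∣_-_∣)
open import Data.Integer as ℤ using (ℤ; +_)
open import Data.Product using (∃; ∃-syntax; _×_; _,_; proj₁; proj₂)
open import Data.Sum using (_⊎_; inj₁; inj₂; [_,_]; [_,_]′)
open import Relation.Binary.PropositionalEquality using (_≡_)

import Data.Nat.Properties as ℕₚ
import Data.Integer.Properties as ℤₚ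
import Data.Product as Prod
import Data.Sum as Sum
open import Data.Sum.Properties using (swap-involutive)
open import Data.Empty using (⊥-elim)
open import Data.Fin as Fin using (Fin; zero; suc; punchIn; punchOut; _↑ˡ_; _↑ʳ_; splitAt; join)
open import Data.Fin.Properties using (join-splitAt; splitAt-join; punchIn-punchOut; any?; all?)
open import Data.Vec.Functional using (Vector; []; _∷_; _++_; insertAt; removeAt)
open import Data.Vec.Functional.Properties using (insertAt-lookup; insertAt-punchIn; lookup-++ˡ; lookup-++ʳ)
open import Data.Vec.Functional.Relation.Unary.All.Properties using (++⁺)
open import Function using (_∘_)
open import Relation.Nullary using (¬_; Dec; yes; no; ¬?; _×-dec_)
open import Relation.Nullary.Decidable using (map′; decidable-stable)
import Relation.Binary.PropositionalEquality as ≡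

m+n≤o⇒+m≤+o-+n : ∀ {m n o} → m ℕ.+ n ≤ o → + m ℤ.≤ + o ℤ.- + n
m+n≤o⇒+m≤+o-+n {m} {n} {o} m+n≤o = begin
  + m                ≡⟨ ≡.cong +_ (ℕₚ.m+n∸n≡m m n) ⟨
  + (m ℕ.+ n ∸ n)    ≡⟨ ℤₚ.⊖-≥ (ℕₚ.m≤n+m n m) ⟨
  (m ℕ.+ n) ℤ.⊖ n    ≤⟨ ℤₚ.⊖-monoˡ-≤ n m+n≤o ⟩
  o ℤ.⊖ n            ≡⟨ ℤₚ.[+m]-[+n]≡m⊖n o n ⟨
  + o ℤ.- + n        ∎
  where open ℤₚ.≤-Reasoning

m+n≤o⇒m+o≤p⇒2m+n≤p : ∀ {m n o p} → m ℕ.+ n ≤ o → m ℕ.+ o ≤ p → 2 ℕ.* m ℕ.+ n ≤ p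
m+n≤o⇒m+o≤p⇒2m+n≤p {m} {n} {o} {p} m+n≤o m+o≤p = begin
  2 ℕ.* m ℕ.+ n       ≡⟨ ≡.cong (λ y → m ℕ.+ y ℕ.+ n) (ℕₚ.+-identityʳ m) ⟩
  m ℕ.+ m ℕ.+ n       ≡⟨ ℕₚ.+-assoc m m n ⟩
  m ℕ.+ (m ℕ.+ n)     ≤⟨ ℕₚ.+-monoʳ-≤ m m+n≤o ⟩
  m ℕ.+ o             ≤⟨ m+o≤p ⟩
  p                   ∎
  where open ℕₚ.≤-Reasoning

[n∸m]+[m+[o∸n]]≡o : ∀ {m n o} → m ≤ n → n ≤ o → (n ∸ m) ℕ.+ (m ℕ.+ (o ∸ n)) ≡ o
[n∸m]+[m+[o∸n]]≡o {m} {n} {o} m≤n n≤o = begin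
  (n ∸ m) ℕ.+ (m ℕ.+ (o ∸ n))   ≡⟨ ℕₚ.+-assoc (n ∸ m) m (o ∸ n) ⟨
  (n ∸ m) ℕ.+ m ℕ.+ (o ∸ n)     ≡⟨ ≡.cong (ℕ._+ (o ∸ n)) (ℕₚ.m∸n+n≡m m≤n) ⟩
  n ℕ.+ (o ∸ n)                 ≡⟨ ℕₚ.m+[n∸m]≡n n≤o ⟩
  o                             ∎
  where open ≡.≡-Reasoning

rank-gap-arith : ∀ {γ α k a b} → γ ≤ α → α ≤ k → α ≤ a →
                 b ≤ γ ℕ.+ (k ∸ α) → k ≤ γ ℕ.+ (a ∸ α) → 2 ℕ.* (α ∸ γ) ℕ.+ b ≤ a
rank-gap-arith {γ} {α} {k} {a} {b} γ≤α α≤k α≤a b≤ k≤ = m+n≤o⇒m+o≤p⇒2m+n≤p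
  (≡.subst (δ ℕ.+ b ≤_) ([n∸m]+[m+[o∸n]]≡o γ≤α α≤k) (ℕₚ.+-monoʳ-≤ δ b≤))
  (≡.subst (δ ℕ.+ k ≤_) ([n∸m]+[m+[o∸n]]≡o γ≤α α≤a) (ℕₚ.+-monoʳ-≤ δ k≤))
  where δ = α ∸ γ

Fin-+-elim : ∀ {m m′} (Q : Fin (m ℕ.+ m′) → Set) →
             (∀ i → Q (i ↑ˡ m′)) → (∀ i → Q (m ↑ʳ i)) → ∀ q → Q q
Fin-+-elim {m} {m′} Q Qˡ Qʳ q =
  ≡.subst Q (join-splitAt m m′ q) ([_,_] {C = Q ∘ join m m′} Qˡ Qʳ (splitAt m q))

swap-↑ : ∀ {r s} → Fin (s ℕ.+ r) → Fin (r ℕ.+ s)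
swap-↑ {r} {s} = join r s ∘ Sum.swap ∘ splitAt s

++-swap-↑ : ∀ {r s} {A : Set} (x : Vector A r) (y : Vector A s) j → (x ++ y) (swap-↑ {r} {s} j) ≡ (y ++ x) j
++-swap-↑ {r} {s} x y j =
  ≡.trans (≡.cong [ x , y ]′ (splitAt-join r s (Sum.swap (splitAt s j)))) (swapped (splitAt s j))
  where
  swapped : ∀ w → [ x , y ]′ (Sum.swap w) ≡ [ y , x ]′ w
  swapped (inj₁ _) = ≡.refl
  swapped (inj₂ _) = ≡.refl

swap-↑-involutive : ∀ {r s} (j : Fin (s ℕ.+ r)) → swap-↑ {s} {r} (swap-↑ {r} {s} j) ≡ j
swap-↑-involutive {r} {s} j = begin
  join s r (Sum.swap (splitAt r (join r s (Sum.swap (splitAt s j)))))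
    ≡⟨ ≡.cong (join s r ∘ Sum.swap) (splitAt-join r s (Sum.swap (splitAt s j))) ⟩
  join s r (Sum.swap (Sum.swap (splitAt s j)))
    ≡⟨ ≡.cong (join s r) (swap-involutive (splitAt s j)) ⟩
  join s r (splitAt s j)
    ≡⟨ join-splitAt s r j ⟩
  j ∎
  where open ≡.≡-Reasoning

module Dimension (F : FiniteField) where
  open FiniteField F hiding (zero)
  open LinAlg F using (Vect; Mat; Pred; sumF; lincomb; Independent; HasDim; RowSpace; Rank; _⊕_; _∩_; DS; _∥_; _⊖_)
  open import Algebra.Properties.Semiring.Sum semiring
    using (sum; sum-cong-≋; ∑-distrib-+; ∑-comm; sum-remove; *-distribˡ-sum; *-distribʳ-sum; sum-replicate-zero)
  open import Algebra.Properties.Ring ring using (-1*x≈-x; -‿distribˡ-*; -‿distribʳ-*; x[y-z]≈xy-xz)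
  open import Algebra.Properties.Group +-group using (inverseˡ-unique; x∙y⁻¹≈ε⇒x≈y)
  open import Data.Vec.Functional.Relation.Binary.Equality.Setoid setoid using (_≋_)
  open import Relation.Binary.Reasoning.Setoid setoid

  -- Finite sums

  sumF≡sum : ∀ {m} (f : Vector Carrier m) → sumF f ≡ sum f
  sumF≡sum {zero}  f = ≡.refl
  sumF≡sum {suc m} f = ≡.cong (_+_ (f zero)) (sumF≡sum (f ∘ suc))

  sumF-cong : ∀ {m} {f g : Vector Carrier m} → f ≋ g → sumF f ≈ sumF g
  sumF-cong {f = f} {g} f≋g = begin
    sumF f ≡⟨ sumF≡sum f ⟩ sum f ≈⟨ sum-cong-≋ f≋g ⟩ sum g ≡⟨ sumF≡sum g ⟨ sumF g ∎

  sumF-zero : ∀ {m} {f : Vector Carrier m} → (∀ i → f i ≈ 0#) → sumF f ≈ 0#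
  sumF-zero {m} f≈0 =
    trans (sumF-cong f≈0) (trans (reflexive (sumF≡sum {m} (λ _ → 0#))) (sum-replicate-zero m))

  sumF-distrib-+ : ∀ {m} (f g : Vector Carrier m) → sumF (λ i → f i + g i) ≈ sumF f + sumF g
  sumF-distrib-+ f g = begin
    sumF (λ i → f i + g i) ≡⟨ sumF≡sum (λ i → f i + g i) ⟩
    sum (λ i → f i + g i)  ≈⟨ ∑-distrib-+ f g ⟩
    sum f + sum g          ≡⟨ ≡.cong₂ _+_ (sumF≡sum f) (sumF≡sum g) ⟨
    sumF f + sumF g        ∎

  *-distribˡ-sumF : ∀ {m} x (f : Vector Carrier m) → x * sumF f ≈ sumF (λ i → x * f i)
  *-distribˡ-sumF x f = begin
    x * sumF f              ≡⟨ ≡.cong (x *_) (sumF≡sum f) ⟩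
    x * sum f               ≈⟨ *-distribˡ-sum x f ⟩
    sum (λ i → x * f i)     ≡⟨ sumF≡sum (λ i → x * f i) ⟨
    sumF (λ i → x * f i)    ∎

  *-distribʳ-sumF : ∀ {m} x (f : Vector Carrier m) → sumF f * x ≈ sumF (λ i → f i * x)
  *-distribʳ-sumF x f = begin
    sumF f * x              ≡⟨ ≡.cong (_* x) (sumF≡sum f) ⟩
    sum f * x               ≈⟨ *-distribʳ-sum x f ⟩
    sum (λ i → f i * x)     ≡⟨ sumF≡sum (λ i → f i * x) ⟨
    sumF (λ i → f i * x)    ∎

  sumF-neg : ∀ {m} (f : Vector Carrier m) → sumF (λ i → - f i) ≈ - sumF f
  sumF-neg f = begin
    sumF (λ i → - f i)       ≈⟨ sumF-cong (λ i → -1*x≈-x (f i)) ⟨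
    sumF (λ i → - 1# * f i)  ≈⟨ *-distribˡ-sumF (- 1#) f ⟨
    - 1# * sumF f            ≈⟨ -1*x≈-x (sumF f) ⟩
    - sumF f                 ∎

  sumF-comm : ∀ {m n} (f : Fin m → Fin n → Carrier) →
              sumF (λ i → sumF (f i)) ≈ sumF (λ j → sumF (λ i → f i j))
  sumF-comm {m} {n} f = begin
    sumF (λ i → sumF (f i))             ≡⟨ sumF≡sum (λ i → sumF (f i)) ⟩
    sum (λ i → sumF (f i))              ≈⟨ sum-cong-≋ (λ i → reflexive (sumF≡sum (f i))) ⟩
    sum (λ i → sum (f i))               ≈⟨ ∑-comm f ⟩
    sum (λ j → sum (λ i → f i j))       ≈⟨ sum-cong-≋ (λ j → reflexive (sumF≡sum (λ i → f i j))) ⟨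
    sum (λ j → sumF (λ i → f i j))      ≡⟨ sumF≡sum (λ j → sumF (λ i → f i j)) ⟨
    sumF (λ j → sumF (λ i → f i j))     ∎

  sumF-removeAt : ∀ {m} (f : Vector Carrier (suc m)) i → sumF f ≈ f i + sumF (removeAt f i)
  sumF-removeAt f i = begin
    sumF f                      ≡⟨ sumF≡sum f ⟩
    sum f                       ≈⟨ sum-remove f ⟩
    f i + sum (removeAt f i)    ≡⟨ ≡.cong (_+_ (f i)) (sumF≡sum (removeAt f i)) ⟨
    f i + sumF (removeAt f i)   ∎

  sumF-++ : ∀ {m n} (f : Vector Carrier (m ℕ.+ n)) →
            sumF f ≈ sumF (λ i → f (i ↑ˡ n)) + sumF (λ j → f (m ↑ʳ j))
  sumF-++ {zero}  f = sym (+-identityˡ _)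
  sumF-++ {suc m} f = trans (+-congˡ (sumF-++ {m} (f ∘ suc))) (sym (+-assoc _ _ _))

  -- Linear combinations and row spaces

  0ᵥ : ∀ {n} → Vect n
  0ᵥ _ = 0#

  lincomb-cong : ∀ {m n} {c c′ : Vect m} {v v′ : Mat m n} →
                 c ≋ c′ → (∀ i → v i ≋ v′ i) → lincomb c v ≋ lincomb c′ v′
  lincomb-cong {m} c≋c′ v≋v′ j = sumF-cong {m} (λ i → *-cong (c≋c′ i) (v≋v′ i j))

  lincomb-congʳ : ∀ {m n} (c : Vect m) {v v′ : Mat m n} → (∀ i → v i ≋ v′ i) → lincomb c v ≋ lincomb c v′
  lincomb-congʳ c = lincomb-cong {c = c} (λ _ → refl)

  lincomb-zeroˡ : ∀ {m n} {c : Vect m} (v : Mat m n) → c ≋ 0ᵥ → lincomb c v ≋ 0ᵥ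
  lincomb-zeroˡ v c≈0 j = sumF-zero (λ i → trans (*-congʳ (c≈0 i)) (zeroˡ (v i j)))

  lincomb-zeroʳ : ∀ {m n} (c : Vect m) {v : Mat m n} → (∀ i → v i ≋ 0ᵥ) → lincomb c v ≋ 0ᵥ
  lincomb-zeroʳ c v≈0 j = sumF-zero (λ i → trans (*-congˡ (v≈0 i j)) (zeroʳ (c i)))

  lincomb-distribʳ : ∀ {m n} (c c′ : Vect m) (v : Mat m n) →
                     lincomb (λ i → c i + c′ i) v ≋ (λ j → lincomb c v j + lincomb c′ v j)
  lincomb-distribʳ {m} c c′ v j =
    trans (sumF-cong {m} (λ i → distribʳ (v i j) (c i) (c′ i))) (sumF-distrib-+ {m} _ _)

  lincomb-* : ∀ {m n} x (c : Vect m) (v : Mat m n) →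
              lincomb (λ i → x * c i) v ≋ (λ j → x * lincomb c v j)
  lincomb-* {m} x c v j =
    trans (sumF-cong {m} (λ i → *-assoc x (c i) (v i j))) (sym (*-distribˡ-sumF {m} x _))

  lincomb-neg : ∀ {m n} (c : Vect m) (v : Mat m n) →
                lincomb (λ i → - c i) v ≋ (λ j → - lincomb c v j)
  lincomb-neg {m} c v j =
    trans (sumF-cong {m} (λ i → sym (-‿distribˡ-* (c i) (v i j)))) (sumF-neg {m} _)

  lincomb-sub : ∀ {m n} (c c′ : Vect m) (v : Mat m n) →
                lincomb (λ i → c i - c′ i) v ≋ (λ j → lincomb c v j - lincomb c′ v j)
  lincomb-sub c c′ v j = trans (lincomb-distribʳ c (λ i → - c′ i) v j) (+-congˡ (lincomb-neg c′ v j))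

  lincomb-⊖ : ∀ {m n} (c : Vect m) (X Y : Mat m n) →
              lincomb c (X ⊖ Y) ≋ (λ j → lincomb c X j - lincomb c Y j)
  lincomb-⊖ {m} c X Y j = begin
    sumF (λ i → c i * (X i j - Y i j))               ≈⟨ sumF-cong {m} (λ i → x[y-z]≈xy-xz (c i) (X i j) (Y i j)) ⟩
    sumF (λ i → c i * X i j - c i * Y i j)           ≈⟨ sumF-distrib-+ {m} _ _ ⟩
    lincomb c X j + sumF (λ i → - (c i * Y i j))     ≈⟨ +-congˡ (sumF-neg {m} _) ⟩
    lincomb c X j - lincomb c Y j                    ∎

  lincomb-assoc : ∀ {l m n} (c : Vect l) (H : Mat l m) (R : Mat m n) →
                  lincomb c (λ q → lincomb (H q) R) ≋ lincomb (lincomb c H) R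
  lincomb-assoc {l} {m} c H R j = begin
    sumF (λ q → c q * sumF (λ i → H q i * R i j))     ≈⟨ sumF-cong {l} (λ q → *-distribˡ-sumF {m} (c q) _) ⟩
    sumF (λ q → sumF (λ i → c q * (H q i * R i j)))
      ≈⟨ sumF-cong {l} (λ q → sumF-cong {m} (λ i → *-assoc (c q) (H q i) (R i j))) ⟨
    sumF (λ q → sumF (λ i → (c q * H q i) * R i j))   ≈⟨ sumF-comm {l} {m} _ ⟩
    sumF (λ i → sumF (λ q → (c q * H q i) * R i j))   ≈⟨ sumF-cong {m} (λ i → *-distribʳ-sumF {l} (R i j) _) ⟨
    sumF (λ i → lincomb c H i * R i j)                ∎

  lincomb-removeAt : ∀ {m n} (c : Vect (suc m)) (v : Mat (suc m) n) i →
                     lincomb c v ≋ (λ j → c i * v i j + lincomb (removeAt c i) (removeAt v i) j)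
  lincomb-removeAt c v i j = sumF-removeAt (λ q → c q * v q j) i

  lincomb-insertAt : ∀ {m n} (d : Vect m) i x (v : Mat (suc m) n) →
                     lincomb (insertAt d i x) v ≋ (λ j → x * v i j + lincomb d (removeAt v i) j)
  lincomb-insertAt d i x v j = trans (lincomb-removeAt (insertAt d i x) v i j)
    (+-cong (*-congʳ (reflexive (insertAt-lookup d i x)))
            (lincomb-cong {v = removeAt v i} (λ q → reflexive (insertAt-punchIn d i x q)) (λ _ _ → refl) j))

  lincomb-↑ : ∀ {m m′ n} (c : Vect (m ℕ.+ m′)) (w : Mat (m ℕ.+ m′) n) →
              lincomb c w ≋ (λ j → lincomb (c ∘ (_↑ˡ m′)) (w ∘ (_↑ˡ m′)) j
                                 + lincomb (c ∘ (m ↑ʳ_)) (w ∘ (m ↑ʳ_)) j)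
  lincomb-↑ {m} c w j = sumF-++ {m} (λ q → c q * w q j)

  lincomb-++ : ∀ {m m′ n} (c : Vect (m ℕ.+ m′)) (x : Mat m n) (y : Mat m′ n) →
               lincomb c (x ++ y) ≋ (λ j → lincomb (c ∘ (_↑ˡ m′)) x j + lincomb (c ∘ (m ↑ʳ_)) y j)
  lincomb-++ {m} {m′} c x y j = trans (lincomb-↑ {m} {m′} c (x ++ y) j)
    (+-cong (lincomb-congʳ _ (λ i → reflexive ∘ ≡.cong-app (lookup-++ˡ x y i)) j)
            (lincomb-congʳ _ (λ i → reflexive ∘ ≡.cong-app (lookup-++ʳ x y i)) j))

  RowSpace-resp : ∀ {k n} (R : Mat k n) {x y : Vect n} → x ≋ y → RowSpace R x → RowSpace R y
  RowSpace-resp R x≋y (c , x≋cR) = c , λ j → trans (sym (x≋y j)) (x≋cR j)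

  lincomb∈RowSpace : ∀ {k n} (R : Mat k n) c → RowSpace R (lincomb c R)
  lincomb∈RowSpace R c = c , λ _ → refl

  0∈RowSpace : ∀ {k n} (R : Mat k n) → RowSpace R 0ᵥ
  0∈RowSpace R = 0ᵥ , λ j → sym (lincomb-zeroˡ R (λ _ → refl) j)

  row∈RowSpace : ∀ {k n} (R : Mat k n) i → RowSpace R (R i)
  row∈RowSpace {suc k} R i = insertAt 0ᵥ i 1# , λ j → sym (begin
    lincomb (insertAt 0ᵥ i 1#) R j             ≈⟨ lincomb-insertAt 0ᵥ i 1# R j ⟩
    1# * R i j + lincomb 0ᵥ (removeAt R i) j
      ≈⟨ +-cong (*-identityˡ _) (lincomb-zeroˡ (removeAt R i) (λ _ → refl) j) ⟩
    R i j + 0#                                 ≈⟨ +-identityʳ (R i j) ⟩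
    R i j                                      ∎)

  RowSpace-lincomb : ∀ {k m n} (R : Mat k n) (c : Vect m) (v : Mat m n) →
                     (∀ l → RowSpace R (v l)) → RowSpace R (lincomb c v)
  RowSpace-lincomb R c v v∈R = lincomb c (proj₁ ∘ v∈R) , λ j →
    trans (lincomb-congʳ c (proj₂ ∘ v∈R) j) (lincomb-assoc c (proj₁ ∘ v∈R) R j)

  RowSpace-⊆ : ∀ {k m n} (R : Mat k n) (z : Mat m n) →
               (∀ l → RowSpace R (z l)) → ∀ {x} → RowSpace z x → RowSpace R x
  RowSpace-⊆ R z z∈R (c , x≋cz) = RowSpace-resp R (λ j → sym (x≋cz j)) (RowSpace-lincomb R c z z∈R)

  RowSpace-removeAt : ∀ {m n} (z : Mat (suc m) n) i {x} → RowSpace (removeAt z i) x → RowSpace z x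
  RowSpace-removeAt z i = RowSpace-⊆ z (removeAt z i) (λ q → row∈RowSpace z (punchIn i q))

  RowSpace-solve : ∀ {m n} {a : Carrier} {x : Vect n} (c : Vect m) (v : Mat m n) → ¬ (a ≈ 0#) →
                   (λ j → a * x j + lincomb c v j) ≋ 0ᵥ → RowSpace v x
  RowSpace-solve {a = a} {x} c v a≉0 ax+cv≈0 = (λ l → - ν * c l) , λ j → begin
    x j                        ≈⟨ *-identityˡ (x j) ⟨
    1# * x j                   ≈⟨ *-congʳ (trans (sym aν≈1) (*-comm a ν)) ⟩
    (ν * a) * x j              ≈⟨ *-assoc ν a (x j) ⟩
    ν * (a * x j)              ≈⟨ *-congˡ (inverseˡ-unique _ _ (ax+cv≈0 j)) ⟩
    ν * - lincomb c v j        ≈⟨ -‿distribʳ-* ν _ ⟨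
    - (ν * lincomb c v j)      ≈⟨ -‿distribˡ-* ν _ ⟩
    - ν * lincomb c v j        ≈⟨ lincomb-* (- ν) c v j ⟨
    lincomb (λ l → - ν * c l) v j ∎
    where
    ν : Carrier
    ν = proj₁ (inverse a a≉0)
    aν≈1 : a * ν ≈ 1#
    aν≈1 = proj₂ (inverse a a≉0)

  -- Linear independence

  Independent-resp : ∀ {m n} {v v′ : Mat m n} → (∀ i → v i ≋ v′ i) → Independent v → Independent v′
  Independent-resp v≋v′ v-indep c cv′≈0 = v-indep c (λ j → trans (lincomb-congʳ c v≋v′ j) (cv′≈0 j))

  Independent⇒insertAt-zero : ∀ {m n} {z : Mat (suc m) n} → Independent z → ∀ i x (d : Vect m) →
                              (λ j → x * z i j + lincomb d (removeAt z i) j) ≋ 0ᵥ → x ≈ 0# × d ≋ 0ᵥ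
  Independent⇒insertAt-zero {z = z} z-indep i x d h =
    trans (reflexive (≡.sym (insertAt-lookup d i x))) (e≈0 i) ,
    λ q → trans (reflexive (≡.sym (insertAt-punchIn d i x q))) (e≈0 (punchIn i q))
    where
    e≈0 : insertAt d i x ≋ 0ᵥ
    e≈0 = z-indep (insertAt d i x) (λ j → trans (lincomb-insertAt d i x z j) (h j))

  Independent-removeAt : ∀ {m n} {z : Mat (suc m) n} → Independent z → ∀ i → Independent (removeAt z i)
  Independent-removeAt {z = z} z-indep i d dz′≈0 = proj₂ (Independent⇒insertAt-zero {z = z} z-indep i 0# d
    (λ j → trans (+-cong (zeroˡ (z i j)) (dz′≈0 j)) (+-identityˡ 0#)))

  lincomb∉RowSpace-removeAt : ∀ {m n} {z : Mat (suc m) n} → Independent z → ∀ c i → ¬ (c i ≈ 0#) →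
                              ¬ RowSpace (removeAt z i) (lincomb c z)
  lincomb∉RowSpace-removeAt {m} {n} {z} z-indep c i ci≉0 (d , cz≋dz′) =
    ci≉0 (proj₁ (Independent⇒insertAt-zero {z = z} z-indep i (c i) (λ q → c′ q - d q) λ j → begin
      c i * z i j + lincomb (λ q → c′ q - d q) z′ j         ≈⟨ +-congˡ (lincomb-sub c′ d z′ j) ⟩
      c i * z i j + (lincomb c′ z′ j - lincomb d z′ j)      ≈⟨ +-assoc _ _ _ ⟨
      (c i * z i j + lincomb c′ z′ j) - lincomb d z′ j      ≈⟨ +-congʳ (lincomb-removeAt c z i j) ⟨
      lincomb c z j - lincomb d z′ j                        ≈⟨ +-congʳ (cz≋dz′ j) ⟩
      lincomb d z′ j - lincomb d z′ j                       ≈⟨ -‿inverseʳ _ ⟩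
      0#                                                    ∎))
    where
    c′ : Vect m
    c′ = removeAt c i
    z′ : Mat m n
    z′ = removeAt z i

  Independent-∷ : ∀ {k m n} (W : Mat k n) {x : Vect n} {v : Mat m n} →
                  ¬ RowSpace W x → (∀ l → RowSpace W (v l)) → Independent v → Independent (x ∷ v)
  Independent-∷ W {x} {v} x∉W v∈W v-indep μ h = λ { zero → μ₀≈0 ; (suc l) → μ′≈0 l }
    where
    μ₀≈0 : μ zero ≈ 0#
    μ₀≈0 = decidable-stable (μ zero ≟ 0#) λ μ₀≉0 →
      x∉W (RowSpace-⊆ W v v∈W (RowSpace-solve (μ ∘ suc) v μ₀≉0 h))
    μ′≈0 : μ ∘ suc ≋ 0ᵥ
    μ′≈0 = v-indep (μ ∘ suc) λ j → begin
      lincomb (μ ∘ suc) v j                  ≈⟨ +-identityˡ _ ⟨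
      0# + lincomb (μ ∘ suc) v j             ≈⟨ +-congʳ (trans (*-congʳ μ₀≈0) (zeroˡ (x j))) ⟨
      μ zero * x j + lincomb (μ ∘ suc) v j   ≈⟨ h j ⟩
      0#                                     ∎

  NontrivialRelation : ∀ {m n} → Mat m n → Vect m → Set
  NontrivialRelation v c = lincomb c v ≋ 0ᵥ × ∃[ i ] ¬ (c i ≈ 0#)

  Dependent : ∀ {m n} → Mat m n → Set
  Dependent v = ∃ (NontrivialRelation v)

  NontrivialRelation-resp : ∀ {m n} (v : Mat m n) {c c′} → c ≋ c′ →
                            NontrivialRelation v c → NontrivialRelation v c′
  NontrivialRelation-resp v c≋c′ (cv≈0 , i , cᵢ≉0) =
    (λ j → trans (sym (lincomb-cong {v = v} c≋c′ (λ _ _ → refl) j)) (cv≈0 j)) ,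
    i , λ c′ᵢ≈0 → cᵢ≉0 (trans (c≋c′ i) c′ᵢ≈0)

  NontrivialRelation? : ∀ {m n} (v : Mat m n) c → Dec (NontrivialRelation v c)
  NontrivialRelation? v c = all? (λ j → lincomb c v j ≟ 0#) ×-dec any? (λ i → ¬? (c i ≟ 0#))

  ∃-Vect? : ∀ m {P : Vect m → Set} → (∀ {c c′} → c ≋ c′ → P c → P c′) →
            (∀ c → Dec (P c)) → Dec (∃ P)
  ∃-Vect? zero    resp P? = map′ ([] ,_) (λ (c , p) → resp (λ ()) p) (P? [])
  ∃-Vect? (suc m) {P} resp P? = map′ (λ (i , c , p) → enum i ∷ c , p) enumerated
    (any? λ i → ∃-Vect? m (λ c≋c′ → resp λ { zero → refl ; (suc l) → c≋c′ l }) (P? ∘ (enum i ∷_)))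
    where
    enumerated : ∃ P → ∃[ i ] ∃[ c ] P (enum i ∷ c)
    enumerated (c , p) = let (i , eᵢ≈c₀) = enum-onto (c zero) in
      i , c ∘ suc , resp (λ { zero → sym eᵢ≈c₀ ; (suc l) → refl }) p

  independent-or-dependent : ∀ {m n} (v : Mat m n) → Independent v ⊎ Dependent v
  independent-or-dependent {m} v with ∃-Vect? m (NontrivialRelation-resp v) (NontrivialRelation? v)
  ... | yes dependent = inj₂ dependent
  ... | no ¬dependent = inj₁ λ c cv≈0 i →
    decidable-stable (c i ≟ 0#) λ cᵢ≉0 → ¬dependent (c , cv≈0 , i , cᵢ≉0)

  -- Steinitz exchange

  RowSpace-tail : ∀ {m n} (w : Mat (suc m) n) (c : Vect (suc m)) {x : Vect n} →
                  x ≋ lincomb c w → c zero ≈ 0# → RowSpace (w ∘ suc) x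
  RowSpace-tail w c x≋cw c₀≈0 = c ∘ suc , λ j →
    trans (x≋cw j) (trans (+-congʳ (trans (*-congʳ c₀≈0) (zeroˡ (w zero j)))) (+-identityˡ _))

  Independent-eliminate : ∀ {p n} {v : Mat (suc p) n} → Independent v → ∀ i (k : Vect p) →
                          Independent (removeAt v i ⊖ (λ q j → k q * v i j))
  Independent-eliminate {p} {n} {v} v-indep i k λs h =
    proj₂ (Independent⇒insertAt-zero {z = v} v-indep i (- S) λs λ j → begin
    - S * v i j + lincomb λs v′ j                 ≈⟨ +-comm _ _ ⟩
    lincomb λs v′ j + - S * v i j                 ≈⟨ +-congˡ (-‿distribˡ-* S (v i j)) ⟨
    lincomb λs v′ j - S * v i j
      ≈⟨ +-congˡ (-‿cong (*-distribʳ-sumF (v i j) (λ q → λs q * k q))) ⟩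
    lincomb λs v′ j - sumF (λ q → (λs q * k q) * v i j)
      ≈⟨ +-congˡ (-‿cong (sumF-cong {p} (λ q → *-assoc (λs q) (k q) (v i j)))) ⟩
    lincomb λs v′ j - lincomb λs (λ q j → k q * v i j) j
                                                  ≈⟨ lincomb-⊖ λs v′ (λ q j → k q * v i j) j ⟨
    lincomb λs (v′ ⊖ (λ q j → k q * v i j)) j     ≈⟨ h j ⟩
    0#                                            ∎)
    where
    v′ : Mat p n
    v′ = removeAt v i
    S : Carrier
    S = sumF (λ q → λs q * k q)

  steinitz : ∀ m {p n} (w : Mat m n) (v : Mat p n) → Independent v → (∀ i → RowSpace w (v i)) → p ≤ m
  steinitz zero    {zero}  w v _ _ = z≤n
  steinitz zero    {suc p} w v v-indep v∈w =
    ⊥-elim (0≉1 (sym (v-indep (λ _ → 1#) (lincomb-zeroʳ (λ _ → 1#) (proj₂ ∘ v∈w)) zero)))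
  steinitz (suc m) {zero}  w v _ _ = z≤n
  steinitz (suc m) {suc p} {n} w v v-indep v∈w = by-pivot (any? λ i → ¬? (C i zero ≟ 0#))
    where
    C : Mat (suc p) (suc m)
    C = proj₁ ∘ v∈w
    by-pivot : Dec (∃[ i ] ¬ (C i zero ≈ 0#)) → suc p ≤ suc m
    by-pivot (no no-pivot) = ℕₚ.m≤n⇒m≤1+n (steinitz m (w ∘ suc) v v-indep λ i →
      RowSpace-tail w (C i) (proj₂ (v∈w i))
        (decidable-stable (C i zero ≟ 0#) λ Cᵢ₀≉0 → no-pivot (i , Cᵢ₀≉0)))
    -- Gaussian elimination: subtracting k q times the pivot vector v i clears the w zero coefficient.
    by-pivot (yes (i , Cᵢ₀≉0)) = s≤s (steinitz m (w ∘ suc) (removeAt v i ⊖ (λ q j → k q * v i j))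
                                          (Independent-eliminate {v = v} v-indep i k) eliminated∈)
      where
      ν : Carrier
      ν = proj₁ (inverse (C i zero) Cᵢ₀≉0)
      k : Vect p
      k q = C (punchIn i q) zero * ν
      k-cancels : ∀ q → k q * C i zero ≈ C (punchIn i q) zero
      k-cancels q = trans (*-assoc _ ν _)
        (trans (*-congˡ (trans (*-comm ν _) (proj₂ (inverse (C i zero) Cᵢ₀≉0)))) (*-identityʳ _))
      eliminated∈ : ∀ q → RowSpace (w ∘ suc) ((removeAt v i ⊖ (λ q j → k q * v i j)) q)
      eliminated∈ q = RowSpace-tail w (λ l → C (punchIn i q) l - k q * C i l) (λ j → begin
        v (punchIn i q) j - k q * v i j
          ≈⟨ +-cong (proj₂ (v∈w (punchIn i q)) j) (-‿cong (*-congˡ (proj₂ (v∈w i) j))) ⟩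
        lincomb (C (punchIn i q)) w j - k q * lincomb (C i) w j
          ≈⟨ +-congˡ (-‿cong (lincomb-* (k q) (C i) w j)) ⟨
        lincomb (C (punchIn i q)) w j - lincomb (λ l → k q * C i l) w j
          ≈⟨ lincomb-sub (C (punchIn i q)) (λ l → k q * C i l) w j ⟨
        lincomb (λ l → C (punchIn i q) l - k q * C i l) w j ∎)
        (trans (+-congˡ (-‿cong (k-cancels q))) (-‿inverseʳ _))

  Rank⇒Independent : ∀ {k n} (A : Mat k n) → Rank A k → Independent A
  Rank⇒Independent A _ with independent-or-dependent A
  ... | inj₁ A-indep = A-indep
  Rank⇒Independent {suc k} A ((v , v∈A , v-indep) , _) | inj₂ (c , cA≈0 , i , cᵢ≉0) =
    ⊥-elim (ℕₚ.1+n≰n (steinitz k (removeAt A i) v v-indep (RowSpace-⊆ (removeAt A i) A rows∈ ∘ v∈A)))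
    where
    rows∈ : ∀ q → RowSpace (removeAt A i) (A q)
    rows∈ q with i Fin.≟ q
    ... | yes ≡.refl = RowSpace-solve (removeAt c i) (removeAt A i) cᵢ≉0 λ j →
                         trans (sym (lincomb-removeAt c A i j)) (cA≈0 j)
    ... | no i≢q = ≡.subst (RowSpace (removeAt A i) ∘ A) (punchIn-punchOut i≢q)
                           (row∈RowSpace (removeAt A i) (punchOut i≢q))

  -- Dimension

  record IsLinear {n n′} (Φ : Vect n → Vect n′) : Set where
    field
      cong         : ∀ {x y} → x ≋ y → Φ x ≋ Φ y
      lincomb-homo : ∀ {m} (c : Vect m) (v : Mat m n) → Φ (lincomb c v) ≋ lincomb c (Φ ∘ v)

    zero-homo : ∀ {x} → x ≋ 0ᵥ → Φ x ≋ 0ᵥ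
    zero-homo {x} x≈0 j = trans (cong x≈0 j) (lincomb-homo [] [] j)

  Kernel : ∀ {n n′} → (Vect n → Vect n′) → Pred n
  Kernel Φ x = Φ x ≋ 0ᵥ

  IndependentIn : ∀ {n} → Pred n → ℕ → Set
  IndependentIn {n} U m = ∃[ v ] ((∀ i → U (v i)) × Independent {m} {n} v)

  DimBound : ∀ {n} → Pred n → ℕ → Set
  DimBound {n} U g = ∀ m (v : Mat m n) → (∀ i → U (v i)) → Independent v → m ≤ g

  Independent-preimage : ∀ {m n n′} {Φ : Vect n → Vect n′} → IsLinear Φ → (v : Mat m n) →
                         Independent (Φ ∘ v) → Independent v
  Independent-preimage Φ-linear v Φv-indep c cv≈0 =
    Φv-indep c λ j → trans (sym (lincomb-homo c v j)) (zero-homo cv≈0 j)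
    where open IsLinear Φ-linear

  dim≤image+kernel : ∀ {n n′ g} {Φ : Vect n → Vect n′} {Y : Pred n′} → IsLinear Φ → DimBound Y g →
                     ∀ {b} h (z : Mat b n) → Independent z → (∀ i → Y (Φ (z i))) →
                     DimBound (RowSpace z ∩ Kernel Φ) h → b ≤ g ℕ.+ h
  -- If Φ ∘ z is dependent, a nontrivial combination x of z lies in the kernel; since x is outside the
  -- span of z without the i-th vector, it extends kernel families there, and the kernel bound drops by one.
  dim≤image+kernel _ _ {zero} _ _ _ _ _ = z≤n
  dim≤image+kernel {n} {g = g} {Φ = Φ} {Y} Φ-linear Y≤g {suc b} h z z-indep Φz∈Y ker≤h
    with independent-or-dependent (Φ ∘ z)
  ... | inj₁ Φz-indep = ℕₚ.≤-trans (Y≤g (suc b) (Φ ∘ z) Φz∈Y Φz-indep) (ℕₚ.m≤m+n g h)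
  ... | inj₂ (c , cΦz≈0 , i , cᵢ≉0) = shrink h ker≤h
    where
    open IsLinear Φ-linear
    x : Vect n
    x = lincomb c z
    x∈ : (RowSpace z ∩ Kernel Φ) x
    x∈ = lincomb∈RowSpace z c , λ j → trans (lincomb-homo c z j) (cΦz≈0 j)
    x∉ : ¬ RowSpace (removeAt z i) x
    x∉ = lincomb∉RowSpace-removeAt {z = z} z-indep c i cᵢ≉0
    shrink : ∀ h → DimBound (RowSpace z ∩ Kernel Φ) h → suc b ≤ g ℕ.+ h
    shrink zero ker≤0
      with ker≤0 1 (x ∷ []) (λ { zero → x∈ }) (Independent-∷ (removeAt z i) {v = []} x∉ (λ ()) (λ _ _ ()))
    ... | ()
    shrink (suc h) ker≤1+h = ≡.subst (suc b ≤_) (≡.sym (ℕₚ.+-suc g h))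
      (s≤s (dim≤image+kernel {Y = Y} Φ-linear Y≤g h (removeAt z i) (Independent-removeAt {z = z} z-indep i)
                             (Φz∈Y ∘ punchIn i) ker′≤h))
      where
      ker′≤h : DimBound (RowSpace (removeAt z i) ∩ Kernel Φ) h
      ker′≤h m v v∈ v-indep = ℕₚ.≤-pred (ker≤1+h (suc m) (x ∷ v)
        (λ { zero → x∈ ; (suc l) → RowSpace-removeAt z i (proj₁ (v∈ l)) , proj₂ (v∈ l) })
        (Independent-∷ (removeAt z i) x∉ (proj₁ ∘ v∈) v-indep))

  Independent-++ : ∀ {m m′ n n′} {Φ : Vect n → Vect n′} → IsLinear Φ → (x : Mat m n) (y : Mat m′ n) →
                   Independent (Φ ∘ x) → (∀ l → Kernel Φ (y l)) → Independent y → Independent (x ++ y)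
  Independent-++ {m} {m′} {Φ = Φ} Φ-linear x y Φx-indep Φy≈0 y-indep λs h =
    Fin-+-elim (λ q → λs q ≈ 0#) λˡ≈0 λʳ≈0
    where
    open IsLinear Φ-linear
    λˡ : Vect m
    λˡ = λs ∘ (_↑ˡ m′)
    λʳ : Vect m′
    λʳ = λs ∘ (m ↑ʳ_)
    λˡ≈0 : λˡ ≋ 0ᵥ
    λˡ≈0 = Φx-indep λˡ λ j → begin
      lincomb λˡ (Φ ∘ x) j                                    ≈⟨ +-identityʳ _ ⟨
      lincomb λˡ (Φ ∘ x) j + 0#                               ≈⟨ +-congˡ (lincomb-zeroʳ λʳ Φy≈0 j) ⟨
      lincomb λˡ (Φ ∘ x) j + lincomb λʳ (Φ ∘ y) j
        ≈⟨ +-cong (lincomb-congʳ λˡ (λ i → reflexive ∘ ≡.cong-app (≡.cong Φ (lookup-++ˡ x y i))) j)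
                  (lincomb-congʳ λʳ (λ i → reflexive ∘ ≡.cong-app (≡.cong Φ (lookup-++ʳ x y i))) j) ⟨
      lincomb λˡ (Φ ∘ (x ++ y) ∘ (_↑ˡ m′)) j + lincomb λʳ (Φ ∘ (x ++ y) ∘ (m ↑ʳ_)) j
                                                              ≈⟨ lincomb-↑ {m} {m′} λs (Φ ∘ (x ++ y)) j ⟨
      lincomb λs (Φ ∘ (x ++ y)) j                             ≈⟨ lincomb-homo λs (x ++ y) j ⟨
      Φ (lincomb λs (x ++ y)) j                               ≈⟨ zero-homo h j ⟩
      0#                                                      ∎
    λʳ≈0 : λʳ ≋ 0ᵥ
    λʳ≈0 = y-indep λʳ λ j → begin
      lincomb λʳ y j                       ≈⟨ +-identityˡ _ ⟨
      0# + lincomb λʳ y j                  ≈⟨ +-congʳ (lincomb-zeroˡ x λˡ≈0 j) ⟨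
      lincomb λˡ x j + lincomb λʳ y j      ≈⟨ lincomb-++ λs x y j ⟨
      lincomb λs (x ++ y) j                ≈⟨ h j ⟩
      0#                                   ∎

  Independent-lincomb : ∀ {l m n} (H : Mat l m) (R : Mat m n) → Independent H → Independent R →
                        Independent (λ q → lincomb (H q) R)
  Independent-lincomb H R H-indep R-indep c h =
    H-indep c (R-indep (lincomb c H) λ j → trans (sym (lincomb-assoc c H R j)) (h j))

  Independent-coefficients : ∀ {l m n} (H : Mat l m) (R : Mat m n) (z : Mat l n) →
                             (∀ q → z q ≋ lincomb (H q) R) → Independent z → Independent H
  Independent-coefficients H R z z≋HR z-indep c cH≈0 = z-indep c λ j →
    trans (lincomb-congʳ c z≋HR j) (trans (lincomb-assoc c H R j) (lincomb-zeroˡ R cH≈0 j))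

  restriction-linear : ∀ {n n′} (σ : Fin n′ → Fin n) → IsLinear (λ (x : Vect n) → x ∘ σ)
  restriction-linear σ = record { cong = λ x≋y → x≋y ∘ σ ; lincomb-homo = λ _ _ _ → refl }

  lincomb-linear : ∀ {k n} (M : Mat k n) → IsLinear (λ c → lincomb c M)
  lincomb-linear M = record
    { cong         = λ c≋c′ → lincomb-cong {v = M} c≋c′ (λ _ _ → refl)
    ; lincomb-homo = λ c v j → sym (lincomb-assoc c v M j)
    }

  DimBound-⊆ : ∀ {n g} {U V : Pred n} → (∀ {x} → U x → V x) → DimBound V g → DimBound U g
  DimBound-⊆ U⊆V V≤g m v v∈U = V≤g m v (U⊆V ∘ v∈U)

  dim≤-surjection : ∀ {n n′ m g} {Φ : Vect n → Vect n′} {P : Pred n} {Q : Pred n′} → IsLinear Φ →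
                    (∀ {y} → Q y → ∃[ x ] (P x × Φ x ≋ y)) → IndependentIn Q m → DimBound P g → m ≤ g
  dim≤-surjection {n} {m = m} {Φ = Φ} {P} Φ-linear lift (y , y∈Q , y-indep) P≤g =
    P≤g m x (proj₁ ∘ proj₂ ∘ preimage)
      (Independent-preimage Φ-linear x (Independent-resp (λ l j → sym (proj₂ (proj₂ (preimage l)) j)) y-indep))
    where
    preimage : ∀ l → ∃[ x ] (P x × Φ x ≋ y l)
    preimage l = lift (y∈Q l)
    x : Mat m n
    x = proj₁ ∘ preimage

  RowSpace⊆⊕ˡ : ∀ {k k′ n} (R : Mat k n) (R′ : Mat k′ n) {x} →
                RowSpace R x → (RowSpace R ⊕ RowSpace R′) x
  RowSpace⊆⊕ˡ R R′ x∈R = _ , 0ᵥ , x∈R , 0∈RowSpace R′ , λ j → sym (+-identityʳ _)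

  RowSpace⊆⊕ʳ : ∀ {k k′ n} (R : Mat k n) (R′ : Mat k′ n) {x} →
                RowSpace R′ x → (RowSpace R ⊕ RowSpace R′) x
  RowSpace⊆⊕ʳ R R′ x∈R′ = 0ᵥ , _ , 0∈RowSpace R , x∈R′ , λ j → sym (+-identityˡ _)

  HasDim-unique : ∀ {n} {U : Pred n} {m m′} → HasDim U m → HasDim U m′ → m ≡ m′
  HasDim-unique ((v , v∈ , v-indep) , U≤m) ((v′ , v′∈ , v′-indep) , U≤m′) =
    ℕₚ.≤-antisym (U≤m′ _ v v∈ v-indep) (U≤m _ v′ v′∈ v′-indep)

  HasDim-cong : ∀ {n m} {U V : Pred n} → (∀ {x} → U x → V x) → (∀ {x} → V x → U x) →
                HasDim U m → HasDim V m
  HasDim-cong {U = U} {V} U⊆V V⊆U ((v , v∈ , v-indep) , U≤m) =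
    (v , U⊆V ∘ v∈ , v-indep) , DimBound-⊆ {U = V} {V = U} V⊆U U≤m

  Independent-reindex : ∀ {m n n′} {v : Mat m n} (π : Fin n′ → Fin n) (π′ : Fin n → Fin n′) →
                        (∀ j → π (π′ j) ≡ j) → Independent v → Independent (λ i → v i ∘ π)
  Independent-reindex {v = v} π π′ ππ′ v-indep c h =
    v-indep c λ j → ≡.subst (λ q → lincomb c v q ≈ 0#) (ππ′ j) (h (π′ j))

  HasDim-reindex : ∀ {n n′ m} {U : Pred n} {U′ : Pred n′} (π : Fin n′ → Fin n) (π′ : Fin n → Fin n′) →
                   (∀ j → π (π′ j) ≡ j) → (∀ j → π′ (π j) ≡ j) →
                   (∀ {x} → U x → U′ (x ∘ π)) → (∀ {y} → U′ y → U (y ∘ π′)) →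
                   HasDim U m → HasDim U′ m
  HasDim-reindex π π′ ππ′ π′π U→U′ U′→U ((v , v∈ , v-indep) , U≤m) =
    ((λ i → v i ∘ π) , U→U′ ∘ v∈ , Independent-reindex π π′ ππ′ v-indep) ,
    λ m′ w w∈ w-indep →
      U≤m m′ (λ i → w i ∘ π′) (U′→U ∘ w∈) (Independent-reindex π′ π π′π w-indep)

  RowSpace-reindex : ∀ {k n n′} {R : Mat k n} {R′ : Mat k n′} (π : Fin n′ → Fin n) →
                     (∀ i j → R i (π j) ≡ R′ i j) → ∀ {x} → RowSpace R x → RowSpace R′ (x ∘ π)
  RowSpace-reindex π R∘π≡R′ (c , x≋cR) =
    c , λ j → trans (x≋cR (π j)) (lincomb-congʳ c (λ i j → reflexive (R∘π≡R′ i j)) j)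

  DS-unique : ∀ {n} {U W : Pred n} {e e′} → DS U W e → DS U W e′ → e ≡ e′
  DS-unique {U = U} {W} (_ , _ , dim⊕ , dim∩ , e≡) (_ , _ , dim⊕′ , dim∩′ , e′≡) =
    ≡.trans e≡ (≡.trans (≡.cong₂ (λ x y → + x ℤ.- + y) (HasDim-unique {U = U ⊕ W} dim⊕ dim⊕′)
                                                       (HasDim-unique {U = U ∩ W} dim∩ dim∩′)) (≡.sym e′≡))

  DS-comm : ∀ {n} {U W : Pred n} {e} → DS U W e → DS W U e
  DS-comm {U = U} {W} (a , b , dim⊕ , dim∩ , e≡) =
    a , b , HasDim-cong {U = U ⊕ W} (⊕-comm U W) (⊕-comm W U) dim⊕ ,
            HasDim-cong {U = U ∩ W} Prod.swap Prod.swap dim∩ , e≡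
    where
    ⊕-comm : ∀ (U V : Pred _) {x} → (U ⊕ V) x → (V ⊕ U) x
    ⊕-comm _ _ (u , w , u∈ , w∈ , x≋u+w) = w , u , w∈ , u∈ , λ j → trans (x≋u+w j) (+-comm (u j) (w j))

  -- Block matrices

  module Blocks {k r s : ℕ} where

    left : Vect (r ℕ.+ s) → Vect r
    left x = x ∘ (_↑ˡ s)

    right : Vect (r ℕ.+ s) → Vect s
    right x = x ∘ (r ↑ʳ_)

    left-linear : IsLinear left
    left-linear = restriction-linear (_↑ˡ s)

    right-linear : IsLinear right
    right-linear = restriction-linear (r ↑ʳ_)

    left-∥ : (A : Mat k r) (B : Mat k s) → ∀ i → left ((A ∥ B) i) ≋ A i
    left-∥ A B i j = reflexive (lookup-++ˡ (A i) (B i) j)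

    right-∥ : (A : Mat k r) (B : Mat k s) → ∀ i → right ((A ∥ B) i) ≋ B i
    right-∥ A B i j = reflexive (lookup-++ʳ (A i) (B i) j)

    left-lincomb-∥ : (A : Mat k r) (B : Mat k s) (c : Vect k) → left (lincomb c (A ∥ B)) ≋ lincomb c A
    left-lincomb-∥ A B c = lincomb-congʳ c (left-∥ A B)

    right-lincomb-∥ : (A : Mat k r) (B : Mat k s) (c : Vect k) → right (lincomb c (A ∥ B)) ≋ lincomb c B
    right-lincomb-∥ A B c = lincomb-congʳ c (right-∥ A B)

    RowSpace-left : (A : Mat k r) (B : Mat k s) {x : Vect (r ℕ.+ s)} → RowSpace (A ∥ B) x → RowSpace A (left x)
    RowSpace-left A B (c , x≋) = c , λ j → trans (x≋ (j ↑ˡ s)) (left-lincomb-∥ A B c j)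

    Independent-∥ : (A : Mat k r) (B : Mat k s) → Independent A → Independent (A ∥ B)
    Independent-∥ A B A-indep =
      Independent-preimage left-linear (A ∥ B) (Independent-resp (λ i j → sym (left-∥ A B i j)) A-indep)

    Independent-left : (A : Mat k r) (B : Mat k s) → Independent A → ∀ {m} (z : Mat m (r ℕ.+ s)) →
                       (∀ l → RowSpace (A ∥ B) (z l)) → Independent z → Independent (left ∘ z)
    Independent-left A B A-indep z z∈ z-indep λs h =
      z-indep λs λ j → trans (proj₂ y∈ j) (lincomb-zeroˡ (A ∥ B) e≈0 j)
      where
      y∈ : RowSpace (A ∥ B) (lincomb λs z)
      y∈ = RowSpace-lincomb (A ∥ B) λs z z∈
      e≈0 : proj₁ y∈ ≋ 0ᵥ
      e≈0 = A-indep (proj₁ y∈) λ j →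
        trans (sym (left-lincomb-∥ A B (proj₁ y∈) j)) (trans (sym (proj₂ y∈ (j ↑ˡ s))) (h j))

    dim⊕≤dim⊕-∥ : (A C : Mat k r) (B D : Mat k s) → ∀ {a′ a} →
                  IndependentIn (RowSpace A ⊕ RowSpace C) a′ →
                  DimBound (RowSpace (A ∥ B) ⊕ RowSpace (C ∥ D)) a → a′ ≤ a
    dim⊕≤dim⊕-∥ A C B D = dim≤-surjection left-linear lift
      where
      lift : ∀ {y} → (RowSpace A ⊕ RowSpace C) y →
             ∃[ x ] ((RowSpace (A ∥ B) ⊕ RowSpace (C ∥ D)) x × left x ≋ y)
      lift (_ , _ , (cu , u≋) , (cw , w≋) , y≋u+w) =
        (λ j → lincomb cu (A ∥ B) j + lincomb cw (C ∥ D) j) ,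
        (_ , _ , lincomb∈RowSpace (A ∥ B) cu , lincomb∈RowSpace (C ∥ D) cw , λ _ → refl) ,
        λ j → sym (trans (y≋u+w j) (+-cong (trans (u≋ j) (sym (left-lincomb-∥ A B cu j)))
                                           (trans (w≋ j) (sym (left-lincomb-∥ C D cw j)))))

    dim∩-∥≤dim∩ : (A C : Mat k r) (B D : Mat k s) → Independent A → ∀ {b b′} →
                  IndependentIn (RowSpace (A ∥ B) ∩ RowSpace (C ∥ D)) b →
                  DimBound (RowSpace A ∩ RowSpace C) b′ → b ≤ b′
    dim∩-∥≤dim∩ A C B D A-indep {b} (z , z∈ , z-indep) ∩≤b′ =
      ∩≤b′ b (left ∘ z) (λ l → RowSpace-left A B (proj₁ (z∈ l)) , RowSpace-left C D (proj₂ (z∈ l)))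
        (Independent-left A B A-indep z (proj₁ ∘ z∈) z-indep)

    module _ (A C : Mat k r) (B D : Mat k s) (A≈C : ∀ i j → A i j ≈ C i j) (A-indep : Independent A) where

      E : Mat k (r ℕ.+ s)
      E = (A ∥ B) ⊖ (C ∥ D)

      left-E≈0 : ∀ i → left (E i) ≋ 0ᵥ
      left-E≈0 i j = trans (+-cong (left-∥ A B i j) (-‿cong (left-∥ C D i j)))
                           (trans (+-congʳ (A≈C i j)) (-‿inverseʳ (C i j)))

      right-E : ∀ i → right (E i) ≋ (B ⊖ D) i
      right-E i j = +-cong (right-∥ A B i j) (-‿cong (right-∥ C D i j))

      k+rank⊖≤dim⊕ : ∀ {t a} → IndependentIn (RowSpace (B ⊖ D)) t →
                     DimBound (RowSpace (A ∥ B) ⊕ RowSpace (C ∥ D)) a → k ℕ.+ t ≤ a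
      k+rank⊖≤dim⊕ {t} (y , y∈ , y-indep) ⊕≤a = ⊕≤a (k ℕ.+ t) ((A ∥ B) ++ Y)
        (++⁺ (RowSpace (A ∥ B) ⊕ RowSpace (C ∥ D)) {xs = A ∥ B} {ys = Y}
          (λ i → RowSpace⊆⊕ˡ (A ∥ B) (C ∥ D) (row∈RowSpace (A ∥ B) i)) Y∈)
        (Independent-++ left-linear (A ∥ B) Y (Independent-resp (λ i j → sym (left-∥ A B i j)) A-indep)
          (λ l → lincomb-zeroʳ (g l) left-E≈0) Y-indep)
        where
        g : Mat t k
        g = proj₁ ∘ y∈
        Y : Mat t (r ℕ.+ s)
        Y l = lincomb (g l) E
        Y∈ : ∀ l → (RowSpace (A ∥ B) ⊕ RowSpace (C ∥ D)) (Y l)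
        Y∈ l = _ , _ , lincomb∈RowSpace (A ∥ B) (g l) , lincomb∈RowSpace (C ∥ D) (λ i → - g l i) ,
               λ j → trans (lincomb-⊖ (g l) (A ∥ B) (C ∥ D) j) (+-congˡ (sym (lincomb-neg (g l) (C ∥ D) j)))
        Y-indep : Independent Y
        Y-indep = Independent-preimage right-linear Y (Independent-resp
          (λ l j → trans (proj₂ (y∈ l) j) (sym (lincomb-congʳ (g l) right-E j))) y-indep)

      -- The coefficients of a vector of U ∩ W over A ∥ B and over C ∥ D agree (A = C has independent rows),
      -- so they lie in the left kernel of B ⊖ D; together with the coefficients g of a basis of τ(B ⊖ D)
      -- they form t + b independent vectors of F^k.
      rank⊖+dim∩≤k : ∀ {t b} → DimBound (RowSpace (A ∥ B)) k → IndependentIn (RowSpace (B ⊖ D)) t →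
                     IndependentIn (RowSpace (A ∥ B) ∩ RowSpace (C ∥ D)) b → t ℕ.+ b ≤ k
      rank⊖+dim∩≤k {t} {b} U≤k (y , y∈ , y-indep) (z , z∈ , z-indep) =
        U≤k (t ℕ.+ b) (λ q → lincomb ((g ++ cU) q) (A ∥ B)) (λ q → lincomb∈RowSpace (A ∥ B) ((g ++ cU) q))
          (Independent-lincomb (g ++ cU) (A ∥ B) H-indep (Independent-∥ A B A-indep))
        where
        g : Mat t k
        g = proj₁ ∘ y∈
        cU cW : Mat b k
        cU = proj₁ ∘ proj₁ ∘ z∈
        cW = proj₁ ∘ proj₂ ∘ z∈
        z≋cU : ∀ l → z l ≋ lincomb (cU l) (A ∥ B)
        z≋cU = proj₂ ∘ proj₁ ∘ z∈
        z≋cW : ∀ l → z l ≋ lincomb (cW l) (C ∥ D)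
        z≋cW = proj₂ ∘ proj₂ ∘ z∈
        cU≋cW : ∀ l → cU l ≋ cW l
        cU≋cW l i = x∙y⁻¹≈ε⇒x≈y _ _ (A-indep (λ i → cU l i - cW l i) (λ j → begin
          lincomb (λ i → cU l i - cW l i) A j    ≈⟨ lincomb-sub (cU l) (cW l) A j ⟩
          lincomb (cU l) A j - lincomb (cW l) A j
            ≈⟨ +-cong (sym (trans (z≋cU l (j ↑ˡ s)) (left-lincomb-∥ A B (cU l) j)))
                      (-‿cong (trans (lincomb-congʳ (cW l) A≈C j)
                                     (sym (trans (z≋cW l (j ↑ˡ s)) (left-lincomb-∥ C D (cW l) j))))) ⟩
          z l (j ↑ˡ s) - z l (j ↑ˡ s)            ≈⟨ -‿inverseʳ _ ⟩
          0#                                     ∎) i)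
        cU∈kernel : ∀ l → lincomb (cU l) (B ⊖ D) ≋ 0ᵥ
        cU∈kernel l j = begin
          lincomb (cU l) (B ⊖ D) j                  ≈⟨ lincomb-⊖ (cU l) B D j ⟩
          lincomb (cU l) B j - lincomb (cU l) D j
            ≈⟨ +-congˡ (-‿cong (lincomb-cong {v = D} (cU≋cW l) (λ _ _ → refl) j)) ⟩
          lincomb (cU l) B j - lincomb (cW l) D j
            ≈⟨ +-cong (trans (z≋cU l (r ↑ʳ j)) (right-lincomb-∥ A B (cU l) j))
                      (-‿cong (trans (z≋cW l (r ↑ʳ j)) (right-lincomb-∥ C D (cW l) j))) ⟨
          z l (r ↑ʳ j) - z l (r ↑ʳ j)               ≈⟨ -‿inverseʳ _ ⟩
          0#                                        ∎
        H-indep : Independent (g ++ cU)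
        H-indep = Independent-++ (lincomb-linear (B ⊖ D)) g cU (Independent-resp (proj₂ ∘ y∈) y-indep) cU∈kernel
          (Independent-coefficients cU (A ∥ B) z z≋cU z-indep)

      2rank⊖≤dS : ∀ {t e} → DimBound (RowSpace (A ∥ B)) k → Rank (B ⊖ D) t →
                  DS (RowSpace (A ∥ B)) (RowSpace (C ∥ D)) e → + (2 ℕ.* t) ℤ.≤ e
      2rank⊖≤dS {t} U≤k rank⊖ (a , _ , dim⊕ , dim∩ , ≡.refl) =
        m+n≤o⇒+m≤+o-+n (m+n≤o⇒m+o≤p⇒2m+n≤p
        (rank⊖+dim∩≤k U≤k (proj₁ rank⊖) (proj₁ dim∩))
        (≡.subst (_≤ a) (ℕₚ.+-comm k t) (k+rank⊖≤dim⊕ (proj₁ rank⊖) (proj₂ dim⊕))))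

    module _ (A : Mat k r) (B : Mat k s) {α} (A-basis : IndependentIn (RowSpace A) α) where

      rank+kernel≤ : ∀ {c} {P : Pred (r ℕ.+ s)} → (∀ {x} → RowSpace (A ∥ B) x → P x) → DimBound P c →
                     ∀ m (w : Mat m (r ℕ.+ s)) → (∀ l → (P ∩ Kernel left) (w l)) → Independent w →
                     α ℕ.+ m ≤ c
      rank+kernel≤ {P = P} U⊆P P≤c m w w∈ w-indep = P≤c (α ℕ.+ m) (V ++ w)
        (++⁺ P {xs = V} {ys = w} (λ l → U⊆P (lincomb∈RowSpace (A ∥ B) (cv l))) (proj₁ ∘ w∈))
        (Independent-++ left-linear V w
          (Independent-resp (λ l j → trans (proj₂ (v∈ l) j) (sym (left-lincomb-∥ A B (cv l) j))) v-indep)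
          (proj₂ ∘ w∈) w-indep)
        where
        v : Mat α r
        v = proj₁ A-basis
        v∈ : ∀ l → RowSpace A (v l)
        v∈ = proj₁ (proj₂ A-basis)
        v-indep : Independent v
        v-indep = proj₂ (proj₂ A-basis)
        cv : Mat α k
        cv = proj₁ ∘ v∈
        V : Mat α (r ℕ.+ s)
        V l = lincomb (cv l) (A ∥ B)

      rank≤ : ∀ {c} {P : Pred (r ℕ.+ s)} → (∀ {x} → RowSpace (A ∥ B) x → P x) → DimBound P c → α ≤ c
      rank≤ {c} U⊆P P≤c =
        ≡.subst (_≤ c) (ℕₚ.+-identityʳ α) (rank+kernel≤ U⊆P P≤c 0 [] (λ ()) (λ _ _ ()))

      kernel≤ : ∀ {c} {P : Pred (r ℕ.+ s)} → (∀ {x} → RowSpace (A ∥ B) x → P x) → DimBound P c →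
                DimBound (P ∩ Kernel left) (c ∸ α)
      kernel≤ {c} U⊆P P≤c m w w∈ w-indep =
        ℕₚ.m+n≤o⇒m≤o∸n m (≡.subst (_≤ c) (ℕₚ.+-comm α m) (rank+kernel≤ U⊆P P≤c m w w∈ w-indep))

      dim≤rank+kernel : ∀ {γ c m} {P : Pred (r ℕ.+ s)} (C : Mat k r) (D : Mat k s) → DimBound (RowSpace C) γ →
                        (∀ {x} → RowSpace (A ∥ B) x → P x) → DimBound P c →
                        (z : Mat m (r ℕ.+ s)) → Independent z → (∀ l → RowSpace (C ∥ D) (z l)) →
                        (∀ {x} → RowSpace z x → P x) → m ≤ γ ℕ.+ (c ∸ α)
      dim≤rank+kernel {c = c} {P = P} C D C≤γ U⊆P P≤c z z-indep z∈W span⊆P =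
        dim≤image+kernel {Y = RowSpace C} left-linear C≤γ (c ∸ α) z z-indep (λ l → RowSpace-left C D (z∈W l))
          (DimBound-⊆ {U = RowSpace z ∩ Kernel left} {V = P ∩ Kernel left}
                      (λ (x∈ , x∈ker) → span⊆P x∈ , x∈ker) (kernel≤ U⊆P P≤c))


    dS≤dS-∥ : (A C : Mat k r) (B D : Mat k s) → Independent A → ∀ {e′ e} →
              DS (RowSpace A) (RowSpace C) e′ → DS (RowSpace (A ∥ B)) (RowSpace (C ∥ D)) e → e′ ℤ.≤ e
    dS≤dS-∥ A C B D A-indep (_ , _ , dim⊕′ , dim∩′ , ≡.refl) (_ , _ , dim⊕ , dim∩ , ≡.refl) =
      ℤₚ.+-mono-≤ (ℤ.+≤+ (dim⊕≤dim⊕-∥ A C B D (proj₁ dim⊕′) (proj₂ dim⊕)))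
                  (ℤₚ.neg-mono-≤ (ℤ.+≤+ (dim∩-∥≤dim∩ A C B D A-indep (proj₁ dim∩) (proj₂ dim∩′))))

    rank-gap≤dS : (A C : Mat k r) (B D : Mat k s) → ∀ {α γ e} → γ ≤ α →
                  Rank (A ∥ B) k → Rank (C ∥ D) k → Rank A α → Rank C γ →
                  DS (RowSpace (A ∥ B)) (RowSpace (C ∥ D)) e → + (2 ℕ.* (α ∸ γ)) ℤ.≤ e
    rank-gap≤dS A C B D γ≤α rank-AB ((w , w∈ , w-indep) , _) (A-basis , _) rank-C
                (_ , _ , dim⊕ , ((z , z∈ , z-indep) , _) , ≡.refl) =
      m+n≤o⇒+m≤+o-+n (rank-gap-arith γ≤α
        (rank≤ A B A-basis (λ x∈ → x∈) (proj₂ rank-AB))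
        (rank≤ A B A-basis (RowSpace⊆⊕ˡ (A ∥ B) (C ∥ D)) (proj₂ dim⊕))
        (dim≤rank+kernel A B A-basis C D (proj₂ rank-C) (λ x∈ → x∈) (proj₂ rank-AB)
          z z-indep (proj₂ ∘ z∈) (RowSpace-⊆ (A ∥ B) z (proj₁ ∘ z∈)))
        (dim≤rank+kernel A B A-basis C D (proj₂ rank-C) (RowSpace⊆⊕ˡ (A ∥ B) (C ∥ D)) (proj₂ dim⊕)
          w w-indep w∈ (RowSpace⊆⊕ʳ (A ∥ B) (C ∥ D) ∘ RowSpace-⊆ (C ∥ D) w w∈)))

    2∣rank-gap∣≤dS : (A C : Mat k r) (B D : Mat k s) → ∀ {α γ e} →
                     Rank (A ∥ B) k → Rank (C ∥ D) k → Rank A α → Rank C γ →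
                     DS (RowSpace (A ∥ B)) (RowSpace (C ∥ D)) e → + (2 ℕ.* ∣ α - γ ∣) ℤ.≤ e
    2∣rank-gap∣≤dS A C B D {α} {γ} {e} rank-AB rank-CD rank-A rank-C dS with ℕₚ.≤-total γ α
    ... | inj₁ γ≤α = ≡.subst (λ δ → + (2 ℕ.* δ) ℤ.≤ e) (≡.sym (ℕₚ.m≤n⇒∣n-m∣≡n∸m γ≤α))
                       (rank-gap≤dS A C B D γ≤α rank-AB rank-CD rank-A rank-C dS)
    ... | inj₂ α≤γ = ≡.subst (λ δ → + (2 ℕ.* δ) ℤ.≤ e) (≡.sym (ℕₚ.m≤n⇒∣m-n∣≡n∸m α≤γ))
                       (rank-gap≤dS C A D B α≤γ rank-CD rank-AB rank-C rank-A (DS-comm dS))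

    DS-∥-swap : (A C : Mat k r) (B D : Mat k s) → ∀ {e} →
                DS (RowSpace (A ∥ B)) (RowSpace (C ∥ D)) e → DS (RowSpace (B ∥ A)) (RowSpace (D ∥ C)) e
    DS-∥-swap A C B D (a , b , dim⊕ , dim∩ , e≡) =
      a , b , HasDim-reindex {U = U ⊕ W} {U′ = U′ ⊕ W′} π π′ ππ′ π′π ⊕-swap ⊕-unswap dim⊕ ,
              HasDim-reindex {U = U ∩ W} {U′ = U′ ∩ W′} π π′ ππ′ π′π ∩-swap ∩-unswap dim∩ , e≡
      where
      U W : Pred (r ℕ.+ s)
      U = RowSpace (A ∥ B)
      W = RowSpace (C ∥ D)
      U′ W′ : Pred (s ℕ.+ r)
      U′ = RowSpace (B ∥ A)
      W′ = RowSpace (D ∥ C)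
      π : Fin (s ℕ.+ r) → Fin (r ℕ.+ s)
      π = swap-↑ {r} {s}
      π′ : Fin (r ℕ.+ s) → Fin (s ℕ.+ r)
      π′ = swap-↑ {s} {r}
      ππ′ : ∀ j → π (π′ j) ≡ j
      ππ′ = swap-↑-involutive {s} {r}
      π′π : ∀ j → π′ (π j) ≡ j
      π′π = swap-↑-involutive {r} {s}
      swap : (X : Mat k r) (Y : Mat k s) → ∀ {x} → RowSpace (X ∥ Y) x → RowSpace (Y ∥ X) (x ∘ π)
      swap X Y = RowSpace-reindex π (λ i → ++-swap-↑ (X i) (Y i))
      unswap : (X : Mat k r) (Y : Mat k s) → ∀ {y} → RowSpace (Y ∥ X) y → RowSpace (X ∥ Y) (y ∘ π′)
      unswap X Y = RowSpace-reindex π′ (λ i → ++-swap-↑ (Y i) (X i))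
      ⊕-swap : ∀ {x} → (U ⊕ W) x → (U′ ⊕ W′) (x ∘ π)
      ⊕-swap (u , w , u∈ , w∈ , x≋) = u ∘ π , w ∘ π , swap A B u∈ , swap C D w∈ , x≋ ∘ π
      ⊕-unswap : ∀ {y} → (U′ ⊕ W′) y → (U ⊕ W) (y ∘ π′)
      ⊕-unswap (u , w , u∈ , w∈ , y≋) = u ∘ π′ , w ∘ π′ , unswap A B u∈ , unswap C D w∈ , y≋ ∘ π′
      ∩-swap : ∀ {x} → (U ∩ W) x → (U′ ∩ W′) (x ∘ π)
      ∩-swap (u∈ , w∈) = swap A B u∈ , swap C D w∈
      ∩-unswap : ∀ {y} → (U′ ∩ W′) y → (U ∩ W) (y ∘ π′)
      ∩-unswap (u∈ , w∈) = unswap A B u∈ , unswap C D w∈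

lemma23 : (F : FiniteField) → let open LinAlg F in
    (k r s : ℕ) (d : ℤ) → 1 ≤ k → 1 ≤ r → 1 ≤ s →
    (A C : Mat k r) (B D : Mat k s) →
    Rank (A ∥ B) k → Rank (C ∥ D) k →
    ((Rank A k × Rank C k × ∃[ e ] (DS (RowSpace A) (RowSpace C) e × d ℤ.≤ e))
     ⊎ ((∀ i j → A i j ≈ C i j) × Rank A k × ∃[ t ] (Rank (B ⊖ D) t × d ℤ.≤ + (2 ℕ.* t)))
     ⊎ (∃[ a ] ∃[ c ] (Rank A a × Rank C c × d ℤ.≤ + (2 ℕ.* ∣ a - c ∣)))) →
    (∀ e → DS (RowSpace (A ∥ B)) (RowSpace (C ∥ D)) e → d ℤ.≤ e) ×
    (∀ e e′ → DS (RowSpace (A ∥ B)) (RowSpace (C ∥ D)) e →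
              DS (RowSpace (B ∥ A)) (RowSpace (D ∥ C)) e′ → e ≡ e′)
lemma23 F k r s d _ _ _ A C B D rank-AB rank-CD hypothesis = d≤dS , dS-swap
  where
  open LinAlg F using (Rank; RowSpace; DS; _∥_)
  open Dimension F
  open Blocks

  d≤dS : ∀ e → DS (RowSpace (A ∥ B)) (RowSpace (C ∥ D)) e → d ℤ.≤ e
  d≤dS _ dS = [ (λ (rank-A , _ , _ , dS′ , d≤dS′) →
                    ℤₚ.≤-trans d≤dS′ (dS≤dS-∥ A C B D (Rank⇒Independent A rank-A) dS′ dS))
               , [ (λ (A≈C , rank-A , _ , rank⊖ , d≤2t) →
                      ℤₚ.≤-trans d≤2t
                        (2rank⊖≤dS A C B D A≈C (Rank⇒Independent A rank-A) (proj₂ rank-AB) rank⊖ dS))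
                 , (λ (_ , _ , rank-A , rank-C , d≤2∣α-γ∣) →
                      ℤₚ.≤-trans d≤2∣α-γ∣ (2∣rank-gap∣≤dS A C B D rank-AB rank-CD rank-A rank-C dS))
                 ]′
               ]′ hypothesis

  dS-swap : ∀ e e′ → DS (RowSpace (A ∥ B)) (RowSpace (C ∥ D)) e →
            DS (RowSpace (B ∥ A)) (RowSpace (D ∥ C)) e′ → e ≡ e′
  dS-swap _ _ dS dS′ = DS-unique (DS-∥-swap A C B D dS) dS′
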